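{- Let $k$ and $s$ be positive integers with $s$ odd. Then $\mathbb{Z}_2\times\mathbb{Z}_{2k}$ has an $s$-spanning set of size $2$ if and only if $k\le (s^2-1)/2$.
   Context: $\mathbb{Z}_n=\mathbb{Z}/n\mathbb{Z}$. A subset $A=\{a_1,a_2\}$ of an abelian group $G$ is an $s$-spanning set if every element of $G$ equals $\lambda_1a_1+\lambda_2a_2$ for some integers $\lambda_1,\lambda_2$ with $|\lambda_1|+|\lambda_2|\le s$. -}

module Defs where

open import Data.Nat as ℕ using (ℕ; _≤_)
open import Data.Integer as ℤ using (ℤ; +_; _-_; ∣_∣)
open import Data.Integer.Divisibility using (_∣_)
open import Data.Fin using (Fin; toℕ)
open import Data.Product using (_×_; _,_; ∃₂)
open import Relation.Nullary using (¬_)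
open import Relation.Binary.PropositionalEquality using (_≡_)

G : ℕ → Set
G k = Fin 2 × Fin (2 ℕ.* k)

⟦_⟧ : ∀ {n} → Fin n → ℤ
⟦ i ⟧ = + toℕ i

IsComb : (k : ℕ) → G k → ℤ → G k → ℤ → G k → Set
IsComb k (x , y) l₁ (p₁ , q₁) l₂ (p₂ , q₂) =
  (+ 2 ∣ ((l₁ ℤ.* ⟦ p₁ ⟧ ℤ.+ l₂ ℤ.* ⟦ p₂ ⟧) - ⟦ x ⟧)) ×
  (+ (2 ℕ.* k) ∣ ((l₁ ℤ.* ⟦ q₁ ⟧ ℤ.+ l₂ ℤ.* ⟦ q₂ ⟧) - ⟦ y ⟧))

IsSpanning : (k s : ℕ) → G k → G k → Set
IsSpanning k s a₁ a₂ =
  (g : G k) → ∃₂ λ (l₁ l₂ : ℤ) → (∣ l₁ ∣ ℕ.+ ∣ l₂ ∣ ≤ s) × IsComb k g l₁ a₁ l₂ a₂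

HasSpanningSetOfSize2 : (k s : ℕ) → Set
HasSpanningSetOfSize2 k s =
  ∃₂ λ (a₁ a₂ : G k) → (¬ a₁ ≡ a₂) × IsSpanning k s a₁ a₂

-- Reduced mod 2, a spanning pair a₁, a₂ of ℤ₂ × ℤ₂ₖ must span (ℤ₂)², so the determinant of the
-- matrix (a₁ a₂) is odd.  Hence on the index-2 subgroup H = {b(a₁ + a₂) + 2g} every representation
-- λ₁a₁ + λ₂a₂ has λ₁ ≡ λ₂ ≡ b (mod 2), and (λ₁, λ₂) ↦ ((λ₁ + λ₂)/2, (λ₁ - λ₂)/2) sends the
-- representations with ∣λ₁∣ + ∣λ₂∣ ≤ s = 2m + 1 injectively into [-m, m]²; so 2k = ∣H∣ ≤ s².
-- Conversely take a₁ = (1, m) and a₂ = (1, m + 1): the coefficients λ₁ = u + v + x, λ₂ = u - v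
-- give (x, su - v + mx), and balanced base-s digits u, v ∈ [-m, m] reach every integer of absolute
-- value at most (s² - 1)/2, in particular a representative of every residue mod 2k when k ≤ (s² - 1)/2.
module Submission where

open import Defs

-- The integer operations opened here would clash with ℕ's _*_ in the statement's scope below.
module _ where

  open import Data.Nat as ℕ using (ℕ; zero; suc; _≤_; _<_; s≤s; NonZero)
  import Data.Nat.Properties as ℕ
  import Data.Nat.Divisibility as ℕ
  open import Data.Nat.DivMod using (_/_; _%_; m≡m%n+[m/n]*n; m%n<n; m<n*o⇒m/o<n; m*n/n≡m)
  open import Data.Nat.Primality using (Prime; prime; 2-rough; euclidsLemma)
  import Data.Nat.Tactic.RingSolver as ℕ-Solver
  open import Data.Integer as ℤ using (ℤ; +_; -[1+_]; _⊖_; ∣_∣; -_; _+_; _-_; _*_)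
  import Data.Integer.Properties as ℤ
  import Data.Integer.DivMod as ℤ
  open import Data.Integer.Divisibility.Signed
  import Data.Integer.Divisibility as Unsigned
  open import Data.Integer.Tactic.RingSolver using (solve-∀)
  open import Data.Fin as Fin using (Fin; zero; suc; toℕ; fromℕ<; combine; remQuot)
  import Data.Fin.Properties as Fin
  open import Data.Product using (∃; ∃₂; _×_; _,_; proj₁; proj₂; uncurry)
  open import Data.Sum as Sum using (_⊎_; inj₁; inj₂)
  open import Function using (_∘_)
  open import Function.Bundles using (_⇔_; mk⇔)
  open import Relation.Binary.PropositionalEquality
  open import Relation.Nullary using (¬_; contradiction; yes; no)

  ∣m-n∣n-o⇒∣m-o : ∀ {i} m n o → i ∣ m - n → i ∣ n - o → i ∣ m - o
  ∣m-n∣n-o⇒∣m-o m n o i∣m-n i∣n-o =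
    subst (_ ∣_) (telescope m n o) (∣m∣n⇒∣m+n i∣m-n i∣n-o)
    where
    telescope : ∀ m n o → (m - n) + (n - o) ≡ m - o
    telescope = solve-∀

  ∣m-n⇒∣n-m : ∀ {i} m n → i ∣ m - n → i ∣ n - m
  ∣m-n⇒∣n-m m n i∣m-n = subst (_ ∣_) (negate m n) (∣m⇒∣-m i∣m-n)
    where
    negate : ∀ m n → - (m - n) ≡ n - m
    negate = solve-∀

  euclidsLemmaℤ : ∀ {p} i j → Prime p → + p ∣ i * j → (+ p ∣ i) ⊎ (+ p ∣ j)
  euclidsLemmaℤ i j pp p∣ij =
    Sum.map ∣ᵤ⇒∣ ∣ᵤ⇒∣ (euclidsLemma ∣ i ∣ ∣ j ∣ pp (subst (_ ℕ.∣_) (ℤ.abs-* i j) (∣⇒∣ᵤ p∣ij)))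

  ∣⟦i⟧-⟦j⟧⇒i≡j : ∀ {n} (i j : Fin n) → + n ∣ ⟦ i ⟧ - ⟦ j ⟧ → i ≡ j
  ∣⟦i⟧-⟦j⟧⇒i≡j {n} i j n∣i-j with ∣ ⟦ i ⟧ - ⟦ j ⟧ ∣ in eq
  ... | zero = Fin.toℕ-injective (ℤ.+-injective (ℤ.i-j≡0⇒i≡j _ _ (ℤ.∣i∣≡0⇒i≡0 eq)))
  ... | suc d = contradiction (subst (n ℕ.∣_) eq (∣⇒∣ᵤ n∣i-j)) (ℕ.>⇒∤ d<n)
    where
    d<n : suc d < n
    d<n = subst (_< n) eq (begin-strict
      ∣ ⟦ i ⟧ - ⟦ j ⟧ ∣       ≡⟨ cong ∣_∣ (ℤ.[+m]-[+n]≡m⊖n (toℕ i) (toℕ j)) ⟩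
      ∣ toℕ i ⊖ toℕ j ∣       ≤⟨ ℤ.∣m⊝n∣≤m⊔n (toℕ i) (toℕ j) ⟩
      toℕ i ℕ.⊔ toℕ j         <⟨ ℕ.⊔-lub (Fin.toℕ<n i) (Fin.toℕ<n j) ⟩
      n                       ∎)
      where open ℕ.≤-Reasoning

  residue : (d : ℕ) .{{_ : NonZero d}} → ℤ → Fin d
  residue d a = fromℕ< (ℤ.n%ℕd<d a d)

  residue-congruent : ∀ d .{{_ : NonZero d}} a → + d ∣ ⟦ residue d a ⟧ - a
  residue-congruent d a = divides (- (a ℤ./ℕ d)) (begin
    ⟦ residue d a ⟧ - a                         ≡⟨ cong (λ r → + r - a) (Fin.toℕ-fromℕ< (ℤ.n%ℕd<d a d)) ⟩
    + (a ℤ.%ℕ d) - a                            ≡⟨ cong (λ t → + (a ℤ.%ℕ d) - t) (ℤ.a≡a%ℕn+[a/ℕn]*n a d) ⟩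
    + (a ℤ.%ℕ d) - (+ (a ℤ.%ℕ d) + a ℤ./ℕ d * + d) ≡⟨ cancel (+ (a ℤ.%ℕ d)) (a ℤ./ℕ d) (+ d) ⟩
    - (a ℤ./ℕ d) * + d                          ∎)
    where
    open ≡-Reasoning
    cancel : ∀ r q d → r - (r + q * d) ≡ - q * d
    cancel = solve-∀

  residue≡⇒∣ : ∀ d .{{_ : NonZero d}} a b → residue d a ≡ residue d b → + d ∣ a - b
  residue≡⇒∣ d a b eq = ∣m-n∣n-o⇒∣m-o a ⟦ residue d b ⟧ b
    (∣m-n⇒∣n-m ⟦ residue d b ⟧ a (subst (λ r → + d ∣ ⟦ r ⟧ - a) eq (residue-congruent d a)))
    (residue-congruent d b)

  ∣i±j∣≤n⇒∣i∣+∣j∣≤n : ∀ i j {n} → ∣ i + j ∣ ≤ n → ∣ i - j ∣ ≤ n → ∣ i ∣ ℕ.+ ∣ j ∣ ≤ n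
  ∣i±j∣≤n⇒∣i∣+∣j∣≤n (+ a)    (+ b)     h₊ h₋ = h₊
  ∣i±j∣≤n⇒∣i∣+∣j∣≤n (+ a)    -[1+ b ]  h₊ h₋ = h₋
  ∣i±j∣≤n⇒∣i∣+∣j∣≤n -[1+ a ] -[1+ b ]  h₊ h₋ rewrite ℕ.+-suc a b = h₊
  ∣i±j∣≤n⇒∣i∣+∣j∣≤n -[1+ a ] (+ zero)  h₊ h₋ rewrite ℕ.+-identityʳ a = h₋
  ∣i±j∣≤n⇒∣i∣+∣j∣≤n -[1+ a ] (+ suc b) h₊ h₋ rewrite ℕ.+-suc a b = h₋

  ∣2w∣≤2m+1⇒∣w∣≤m : ∀ w m → ∣ w * + 2 ∣ ≤ suc (2 ℕ.* m) → ∣ w ∣ ≤ m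
  ∣2w∣≤2m+1⇒∣w∣≤m w m h = ℕ.≤-pred (ℕ.*-cancelˡ-< 2 ∣ w ∣ (suc m) (begin-strict
    2 ℕ.* ∣ w ∣    ≡⟨ ℕ.*-comm 2 ∣ w ∣ ⟩
    ∣ w ∣ ℕ.* 2    ≡⟨ ℤ.abs-* w (+ 2) ⟨
    ∣ w * + 2 ∣    ≤⟨ h ⟩
    suc (2 ℕ.* m)  <⟨ ℕ.n<1+n _ ⟩
    2 ℕ.+ 2 ℕ.* m  ≡⟨ ℕ.*-suc 2 m ⟨
    2 ℕ.* suc m    ∎))
    where open ℕ.≤-Reasoning

  2∤1 : ¬ (+ 2 ∣ + 1)
  2∤1 2∣1 with () ← ℕ.∣1⇒≡1 (∣⇒∣ᵤ 2∣1)

  invertible-mod2⇒det-odd : ∀ {p₁ p₂ q₁ q₂} μ₁ μ₂ ν₁ ν₂ →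
    + 2 ∣ (μ₁ * p₁ + μ₂ * p₂) - + 1 → + 2 ∣ (μ₁ * q₁ + μ₂ * q₂) - + 0 →
    + 2 ∣ (ν₁ * p₁ + ν₂ * p₂) - + 0 → + 2 ∣ (ν₁ * q₁ + ν₂ * q₂) - + 1 →
    ¬ (+ 2 ∣ p₁ * q₂ - p₂ * q₁)
  invertible-mod2⇒det-odd {p₁} {p₂} {q₁} {q₂} μ₁ μ₂ ν₁ ν₂ hμp hμq hνp hνq 2∣det =
    2∤1 (subst (+ 2 ∣_) (one p₁ p₂ q₁ q₂ μ₁ μ₂ ν₁ ν₂)
      (∣m∣n⇒∣m-n (∣n⇒∣m*n (μ₁ * ν₂ - μ₂ * ν₁) 2∣det)
        (∣m∣n⇒∣m-n (∣m∣n⇒∣m+n (∣m⇒∣m*n _ hμp) hνq) (∣m⇒∣m*n _ hμq))))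
    where
    -- det(μ ν) · det(p q) is the determinant of the product matrix, which is ≡ 1 (mod 2).
    one : ∀ p₁ p₂ q₁ q₂ μ₁ μ₂ ν₁ ν₂ →
      (μ₁ * ν₂ - μ₂ * ν₁) * (p₁ * q₂ - p₂ * q₁) -
      (((μ₁ * p₁ + μ₂ * p₂) - + 1) * (ν₁ * q₁ + ν₂ * q₂) + ((ν₁ * q₁ + ν₂ * q₂) - + 1)
        - ((μ₁ * q₁ + μ₂ * q₂) - + 0) * ((ν₁ * p₁ + ν₂ * p₂) - + 0))
      ≡ + 1
    one = solve-∀

  det-odd⇒coefficients-congruent : ∀ {p₁ p₂ q₁ q₂} l₁ l₂ l₁′ l₂′ →
    ¬ (+ 2 ∣ p₁ * q₂ - p₂ * q₁) →
    + 2 ∣ (l₁ * p₁ + l₂ * p₂) - (l₁′ * p₁ + l₂′ * p₂) →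
    + 2 ∣ (l₁ * q₁ + l₂ * q₂) - (l₁′ * q₁ + l₂′ * q₂) →
    (+ 2 ∣ l₁ - l₁′) × (+ 2 ∣ l₂ - l₂′)
  det-odd⇒coefficients-congruent {p₁} {p₂} {q₁} {q₂} l₁ l₂ l₁′ l₂′ det-odd hp hq =
    cancel-det (subst (+ 2 ∣_) (cramer₁ p₁ p₂ q₁ q₂ l₁ l₂ l₁′ l₂′)
                 (∣m∣n⇒∣m-n (∣n⇒∣m*n q₂ hp) (∣n⇒∣m*n p₂ hq))) ,
    cancel-det (subst (+ 2 ∣_) (cramer₂ p₁ p₂ q₁ q₂ l₁ l₂ l₁′ l₂′)
                 (∣m∣n⇒∣m-n (∣n⇒∣m*n p₁ hq) (∣n⇒∣m*n q₁ hp)))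
    where
    cancel-det : ∀ {z} → + 2 ∣ (p₁ * q₂ - p₂ * q₁) * z → + 2 ∣ z
    cancel-det 2∣det*z with euclidsLemmaℤ _ _ (prime 2-rough) 2∣det*z
    ... | inj₁ 2∣det = contradiction 2∣det det-odd
    ... | inj₂ 2∣z   = 2∣z
    cramer₁ : ∀ p₁ p₂ q₁ q₂ l₁ l₂ l₁′ l₂′ →
      q₂ * ((l₁ * p₁ + l₂ * p₂) - (l₁′ * p₁ + l₂′ * p₂)) - p₂ * ((l₁ * q₁ + l₂ * q₂) - (l₁′ * q₁ + l₂′ * q₂))
      ≡ (p₁ * q₂ - p₂ * q₁) * (l₁ - l₁′)
    cramer₁ = solve-∀
    cramer₂ : ∀ p₁ p₂ q₁ q₂ l₁ l₂ l₁′ l₂′ →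
      p₁ * ((l₁ * q₁ + l₂ * q₂) - (l₁′ * q₁ + l₂′ * q₂)) - q₁ * ((l₁ * p₁ + l₂ * p₂) - (l₁′ * p₁ + l₂′ * p₂))
      ≡ (p₁ * q₂ - p₂ * q₁) * (l₂ - l₂′)
    cramer₂ = solve-∀

  ∣u+m∣<2m+1 : ∀ u m → ∣ u ∣ ≤ m → ∣ u + + m ∣ < suc (2 ℕ.* m)
  ∣u+m∣<2m+1 u m ∣u∣≤m = s≤s (begin
    ∣ u + + m ∣       ≤⟨ ℤ.∣i+j∣≤∣i∣+∣j∣ u (+ m) ⟩
    ∣ u ∣ ℕ.+ m       ≤⟨ ℕ.+-monoˡ-≤ m ∣u∣≤m ⟩
    m ℕ.+ m           ≡⟨ cong (m ℕ.+_) (ℕ.+-identityʳ m) ⟨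
    2 ℕ.* m           ∎)
    where open ℕ.≤-Reasoning

  +∣u+m∣≡u+m : ∀ u m → ∣ u ∣ ≤ m → + ∣ u + + m ∣ ≡ u + + m
  +∣u+m∣≡u+m (+ a)    m _     = refl
  +∣u+m∣≡u+m -[1+ a ] m a<m = trans (cong (λ t → + ∣ t ∣) u+m≡m∸[1+a]) (sym u+m≡m∸[1+a])
    where u+m≡m∸[1+a] = ℤ.⊖-≥ a<m

  centre : ∀ m u → ∣ u ∣ ≤ m → Fin (suc (2 ℕ.* m))
  centre m u ∣u∣≤m = fromℕ< (∣u+m∣<2m+1 u m ∣u∣≤m)

  centre-injective : ∀ m u u′ (h : ∣ u ∣ ≤ m) (h′ : ∣ u′ ∣ ≤ m) →
    centre m u h ≡ centre m u′ h′ → u ≡ u′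
  centre-injective m u u′ h h′ eq = begin
    u                    ≡⟨ shift u (+ m) ⟩
    (u + + m) - + m      ≡⟨ cong (_- + m) u+m≡u′+m ⟩
    (u′ + + m) - + m     ≡⟨ shift u′ (+ m) ⟨
    u′                   ∎
    where
    open ≡-Reasoning
    shift : ∀ u m → u ≡ (u + m) - m
    shift = solve-∀
    u+m≡u′+m : u + + m ≡ u′ + + m
    u+m≡u′+m = begin
      u + + m                  ≡⟨ +∣u+m∣≡u+m u m h ⟨
      + ∣ u + + m ∣            ≡⟨ cong +_ (Fin.toℕ-fromℕ< _) ⟨
      + toℕ (centre m u h)     ≡⟨ cong (λ i → + toℕ i) eq ⟩
      + toℕ (centre m u′ h′)   ≡⟨ cong +_ (Fin.toℕ-fromℕ< _) ⟩
      + ∣ u′ + + m ∣           ≡⟨ +∣u+m∣≡u+m u′ m h′ ⟩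
      u′ + + m                 ∎

  -- (l₁ , l₂) ↦ ((l₁ + l₂) / 2 , (l₁ - l₂) / 2)
  halves : ∀ l₁ l₂ → + 2 ∣ l₁ - l₂ → ℤ × ℤ
  halves l₁ l₂ (divides v _) = v + l₂ , v

  halves-bounded : ∀ m l₁ l₂ (h : + 2 ∣ l₁ - l₂) → ∣ l₁ ∣ ℕ.+ ∣ l₂ ∣ ≤ suc (2 ℕ.* m) →
    ∣ proj₁ (halves l₁ l₂ h) ∣ ≤ m × ∣ proj₂ (halves l₁ l₂ h) ∣ ≤ m
  halves-bounded m l₁ l₂ (divides v l₁-l₂≡2v) ∣l₁∣+∣l₂∣≤s =
    ∣2w∣≤2m+1⇒∣w∣≤m (v + l₂) m (subst (λ t → ∣ t ∣ ≤ _) l₁+l₂≡2[v+l₂]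
      (ℕ.≤-trans (ℤ.∣i+j∣≤∣i∣+∣j∣ l₁ l₂) ∣l₁∣+∣l₂∣≤s)) ,
    ∣2w∣≤2m+1⇒∣w∣≤m v m (subst (λ t → ∣ t ∣ ≤ _) l₁-l₂≡2v
      (ℕ.≤-trans (ℤ.∣i-j∣≤∣i∣+∣j∣ l₁ l₂) ∣l₁∣+∣l₂∣≤s))
    where
    regroup : ∀ a b → a + b ≡ (a - b) + b * + 2
    regroup = solve-∀
    factor : ∀ v b → v * + 2 + b * + 2 ≡ (v + b) * + 2
    factor = solve-∀
    l₁+l₂≡2[v+l₂] : l₁ + l₂ ≡ (v + l₂) * + 2
    l₁+l₂≡2[v+l₂] = trans (regroup l₁ l₂) (trans (cong (_+ l₂ * + 2) l₁-l₂≡2v) (factor v l₂))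

  halves-injective : ∀ {l₁ l₂ l₁′ l₂′} (h : + 2 ∣ l₁ - l₂) (h′ : + 2 ∣ l₁′ - l₂′) →
    halves l₁ l₂ h ≡ halves l₁′ l₂′ h′ → l₁ ≡ l₁′ × l₂ ≡ l₂′
  halves-injective {l₁} {l₂} {l₁′} {l₂′} (divides v eq) (divides v′ eq′) e = l₁≡l₁′ , l₂≡l₂′
    where
    open ≡-Reasoning
    unshift : ∀ v l → l ≡ (v + l) - v
    unshift = solve-∀
    unsplit : ∀ a b → a ≡ (a - b) + b
    unsplit = solve-∀
    v≡v′ : v ≡ v′
    v≡v′ = cong proj₂ e
    v+l₂≡v′+l₂′ : v + l₂ ≡ v′ + l₂′
    v+l₂≡v′+l₂′ = cong proj₁ e
    l₂≡l₂′ : l₂ ≡ l₂′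
    l₂≡l₂′ = begin
      l₂              ≡⟨ unshift v l₂ ⟩
      (v + l₂) - v    ≡⟨ cong₂ _-_ v+l₂≡v′+l₂′ v≡v′ ⟩
      (v′ + l₂′) - v′ ≡⟨ unshift v′ l₂′ ⟨
      l₂′             ∎
    l₁≡l₁′ : l₁ ≡ l₁′
    l₁≡l₁′ = begin
      l₁                ≡⟨ unsplit l₁ l₂ ⟩
      (l₁ - l₂) + l₂    ≡⟨ cong (_+ l₂) eq ⟩
      v * + 2 + l₂      ≡⟨ cong₂ (λ v l → v * + 2 + l) v≡v′ l₂≡l₂′ ⟩
      v′ * + 2 + l₂′    ≡⟨ cong (_+ l₂′) eq′ ⟨
      (l₁′ - l₂′) + l₂′ ≡⟨ unsplit l₁′ l₂′ ⟨
      l₁′               ∎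

  Square : ℕ → Set
  Square m = Fin (suc (2 ℕ.* m)) × Fin (suc (2 ℕ.* m))

  toSquare : ∀ m l₁ l₂ → + 2 ∣ l₁ - l₂ → ∣ l₁ ∣ ℕ.+ ∣ l₂ ∣ ≤ suc (2 ℕ.* m) → Square m
  toSquare m l₁ l₂ h b =
    centre m (proj₁ (halves l₁ l₂ h)) (proj₁ (halves-bounded m l₁ l₂ h b)) ,
    centre m (proj₂ (halves l₁ l₂ h)) (proj₂ (halves-bounded m l₁ l₂ h b))

  toSquare-injective : ∀ m l₁ l₂ l₁′ l₂′ h h′ b b′ →
    toSquare m l₁ l₂ h b ≡ toSquare m l₁′ l₂′ h′ b′ → l₁ ≡ l₁′ × l₂ ≡ l₂′
  toSquare-injective m l₁ l₂ l₁′ l₂′ h h′ b b′ e = halves-injective {l₁} {l₂} {l₁′} {l₂′} h h′ (cong₂ _,_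
    (centre-injective m _ _ (proj₁ bounds) (proj₁ bounds′) (cong proj₁ e))
    (centre-injective m _ _ (proj₂ bounds) (proj₂ bounds′) (cong proj₂ e)))
    where
    bounds = halves-bounded m l₁ l₂ h b
    bounds′ = halves-bounded m l₁′ l₂′ h′ b′

  ×-injective⇒≤ : ∀ {a b c d} (f : Fin a × Fin b → Fin c × Fin d) →
    (∀ {x y} → f x ≡ f y → x ≡ y) → a ℕ.* b ≤ c ℕ.* d
  ×-injective⇒≤ {a} {b} {c} {d} f f-injective =
    Fin.injective⇒≤ {f = uncurry combine ∘ f ∘ remQuot {a} b} λ {i} {j} eq → begin
      i                                  ≡⟨ Fin.combine-remQuot {a} b i ⟨
      uncurry combine (remQuot {a} b i)  ≡⟨ cong (uncurry combine) (f-injective (combine-injective eq)) ⟩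
      uncurry combine (remQuot {a} b j)  ≡⟨ Fin.combine-remQuot {a} b j ⟩
      j                                  ∎
    where
    open ≡-Reasoning
    combine-injective : ∀ {x y : Fin c × Fin d} → uncurry combine x ≡ uncurry combine y → x ≡ y
    combine-injective {i , j} {k , l} eq = uncurry (cong₂ _,_) (Fin.combine-injective i j k l eq)

  2∣2k : ∀ k → + 2 ∣ + (2 ℕ.* k)
  2∣2k k = ∣ᵤ⇒∣ (ℕ.m∣m*n k)

  IsComb⇒mod2 : ∀ k {x y p₁ q₁ p₂ q₂} l₁ l₂ → IsComb k (x , y) l₁ (p₁ , q₁) l₂ (p₂ , q₂) →
    (+ 2 ∣ (l₁ * ⟦ p₁ ⟧ + l₂ * ⟦ p₂ ⟧) - ⟦ x ⟧) × (+ 2 ∣ (l₁ * ⟦ q₁ ⟧ + l₂ * ⟦ q₂ ⟧) - ⟦ y ⟧)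
  IsComb⇒mod2 k l₁ l₂ (2∣x , 2k∣y) = ∣ᵤ⇒∣ 2∣x , ∣-trans (2∣2k k) (∣ᵤ⇒∣ 2k∣y)

  IsComb-unique : ∀ k {g g′ a₁ a₂} l₁ l₂ → IsComb k g l₁ a₁ l₂ a₂ → IsComb k g′ l₁ a₁ l₂ a₂ → g ≡ g′
  IsComb-unique k {x , y} {x′ , y′} {p₁ , q₁} {p₂ , q₂} l₁ l₂ (2∣x , 2k∣y) (2∣x′ , 2k∣y′) =
    cong₂ _,_ (same-residue (l₁ * ⟦ p₁ ⟧ + l₂ * ⟦ p₂ ⟧) x x′ 2∣x 2∣x′)
              (same-residue (l₁ * ⟦ q₁ ⟧ + l₂ * ⟦ q₂ ⟧) y y′ 2k∣y 2k∣y′)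
    where
    same-residue : ∀ {n} c (r r′ : Fin n) → + n Unsigned.∣ c - ⟦ r ⟧ → + n Unsigned.∣ c - ⟦ r′ ⟧ → r ≡ r′
    same-residue c r r′ h h′ = ∣⟦i⟧-⟦j⟧⇒i≡j r r′
      (∣m-n∣n-o⇒∣m-o ⟦ r ⟧ c ⟦ r′ ⟧ (∣m-n⇒∣n-m c ⟦ r ⟧ (∣ᵤ⇒∣ h)) (∣ᵤ⇒∣ h′))

  module Necessity {k m : ℕ} .{{_ : NonZero k}} {p₁ p₂ : Fin 2} {q₁ q₂ : Fin (2 ℕ.* k)}
    (spanning : IsSpanning k (suc (2 ℕ.* m)) (p₁ , q₁) (p₂ , q₂)) where

    instance
      2k≢0 : NonZero (2 ℕ.* k)
      2k≢0 = ℕ.m*n≢0 2 k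

    X Y : ℤ → ℤ → ℤ
    X l₁ l₂ = l₁ * ⟦ p₁ ⟧ + l₂ * ⟦ p₂ ⟧
    Y l₁ l₂ = l₁ * ⟦ q₁ ⟧ + l₂ * ⟦ q₂ ⟧

    IsComb-residue⇒mod2 : ∀ {x} c l₁ l₂ → IsComb k (x , residue (2 ℕ.* k) c) l₁ (p₁ , q₁) l₂ (p₂ , q₂) →
      (+ 2 ∣ X l₁ l₂ - ⟦ x ⟧) × (+ 2 ∣ Y l₁ l₂ - c)
    IsComb-residue⇒mod2 c l₁ l₂ comb with IsComb⇒mod2 k l₁ l₂ comb
    ... | 2∣X-x , 2∣Y-y = 2∣X-x ,
      ∣m-n∣n-o⇒∣m-o (Y l₁ l₂) ⟦ residue (2 ℕ.* k) c ⟧ c 2∣Y-y (∣-trans (2∣2k k) (residue-congruent (2 ℕ.* k) c))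

    det-odd : ¬ (+ 2 ∣ ⟦ p₁ ⟧ * ⟦ q₂ ⟧ - ⟦ p₂ ⟧ * ⟦ q₁ ⟧)
    det-odd with spanning (suc zero , residue (2 ℕ.* k) (+ 0)) | spanning (zero , residue (2 ℕ.* k) (+ 1))
    ... | μ₁ , μ₂ , _ , cμ | ν₁ , ν₂ , _ , cν =
      let hμp , hμq = IsComb-residue⇒mod2 {suc zero} (+ 0) μ₁ μ₂ cμ
          hνp , hνq = IsComb-residue⇒mod2 {zero} (+ 1) ν₁ ν₂ cν
      in invertible-mod2⇒det-odd μ₁ μ₂ ν₁ ν₂ hμp hμq hνp hνq

    -- b·(a₁ + a₂) + (0 , 2i): as b and i vary these run through a subgroup of index 2.
    target : Fin 2 → Fin k → G k
    target b i = residue 2 (X ⟦ b ⟧ ⟦ b ⟧) , residue (2 ℕ.* k) (Y ⟦ b ⟧ ⟦ b ⟧ + + 2 * ⟦ i ⟧)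

    target-coefficients : ∀ b i l₁ l₂ → IsComb k (target b i) l₁ (p₁ , q₁) l₂ (p₂ , q₂) →
      (+ 2 ∣ l₁ - ⟦ b ⟧) × (+ 2 ∣ l₂ - ⟦ b ⟧)
    target-coefficients b i l₁ l₂ comb with IsComb-residue⇒mod2 (Y ⟦ b ⟧ ⟦ b ⟧ + + 2 * ⟦ i ⟧) l₁ l₂ comb
    ... | 2∣X-x , 2∣Y-y = det-odd⇒coefficients-congruent l₁ l₂ ⟦ b ⟧ ⟦ b ⟧ det-odd
      (∣m-n∣n-o⇒∣m-o (X l₁ l₂) ⟦ residue 2 (X ⟦ b ⟧ ⟦ b ⟧) ⟧ (X ⟦ b ⟧ ⟦ b ⟧)
        2∣X-x (residue-congruent 2 (X ⟦ b ⟧ ⟦ b ⟧)))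
      (∣m-n∣n-o⇒∣m-o (Y l₁ l₂) (Y ⟦ b ⟧ ⟦ b ⟧ + + 2 * ⟦ i ⟧) (Y ⟦ b ⟧ ⟦ b ⟧)
        2∣Y-y (divides ⟦ i ⟧ (drop-2i (Y ⟦ b ⟧ ⟦ b ⟧) ⟦ i ⟧)))
      where
      drop-2i : ∀ y i → (y + + 2 * i) - y ≡ i * + 2
      drop-2i = solve-∀

    module _ (b : Fin 2) (i : Fin k) where
      coefficient₁ coefficient₂ : ℤ
      coefficient₁ = proj₁ (spanning (target b i))
      coefficient₂ = proj₁ (proj₂ (spanning (target b i)))

      coefficients-bounded : ∣ coefficient₁ ∣ ℕ.+ ∣ coefficient₂ ∣ ≤ suc (2 ℕ.* m)
      coefficients-bounded = proj₁ (proj₂ (proj₂ (spanning (target b i))))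

      coefficients-comb : IsComb k (target b i) coefficient₁ (p₁ , q₁) coefficient₂ (p₂ , q₂)
      coefficients-comb = proj₂ (proj₂ (proj₂ (spanning (target b i))))

      coefficients≡b : (+ 2 ∣ coefficient₁ - ⟦ b ⟧) × (+ 2 ∣ coefficient₂ - ⟦ b ⟧)
      coefficients≡b = target-coefficients b i coefficient₁ coefficient₂ coefficients-comb

      coefficients-same-parity : + 2 ∣ coefficient₁ - coefficient₂
      coefficients-same-parity = ∣m-n∣n-o⇒∣m-o coefficient₁ ⟦ b ⟧ coefficient₂
        (proj₁ coefficients≡b) (∣m-n⇒∣n-m coefficient₂ ⟦ b ⟧ (proj₂ coefficients≡b))

    target-injective : ∀ b i b′ i′ → b ≡ b′ → target b i ≡ target b′ i′ → (b , i) ≡ (b′ , i′)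
    target-injective b i _ i′ refl eq = cong (b ,_) (∣⟦i⟧-⟦j⟧⇒i≡j i i′
      (*-cancelˡ-∣ (+ 2) (subst₂ _∣_ (ℤ.pos-* 2 k) (cancel-y (Y ⟦ b ⟧ ⟦ b ⟧) ⟦ i ⟧ ⟦ i′ ⟧)
        (residue≡⇒∣ (2 ℕ.* k) (Y ⟦ b ⟧ ⟦ b ⟧ + + 2 * ⟦ i ⟧) (Y ⟦ b ⟧ ⟦ b ⟧ + + 2 * ⟦ i′ ⟧)
          (cong proj₂ eq)))))
      where
      cancel-y : ∀ y i i′ → (y + + 2 * i) - (y + + 2 * i′) ≡ + 2 * (i - i′)
      cancel-y = solve-∀

    coefficient₁-determines-b : ∀ b i b′ i′ → coefficient₁ b i ≡ coefficient₁ b′ i′ → b ≡ b′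
    coefficient₁-determines-b b i b′ i′ c₁≡ =
      ∣⟦i⟧-⟦j⟧⇒i≡j b b′ (∣m-n∣n-o⇒∣m-o ⟦ b ⟧ (coefficient₁ b i) ⟦ b′ ⟧
        (∣m-n⇒∣n-m (coefficient₁ b i) ⟦ b ⟧ (proj₁ (coefficients≡b b i)))
        (subst (λ c → + 2 ∣ c - ⟦ b′ ⟧) (sym c₁≡) (proj₁ (coefficients≡b b′ i′))))

    code : Fin 2 × Fin k → Square m
    code (b , i) = toSquare m (coefficient₁ b i) (coefficient₂ b i)
                  (coefficients-same-parity b i) (coefficients-bounded b i)

    code-injective : ∀ {x y} → code x ≡ code y → x ≡ y
    code-injective {b , i} {b′ , i′} eq =
      target-injective b i b′ i′ (coefficient₁-determines-b b i b′ i′ c₁≡) same-target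
      where
      coefficients≡ : coefficient₁ b i ≡ coefficient₁ b′ i′ × coefficient₂ b i ≡ coefficient₂ b′ i′
      coefficients≡ = toSquare-injective m
        (coefficient₁ b i) (coefficient₂ b i) (coefficient₁ b′ i′) (coefficient₂ b′ i′)
        (coefficients-same-parity b i) (coefficients-same-parity b′ i′)
        (coefficients-bounded b i) (coefficients-bounded b′ i′) eq
      c₁≡ = proj₁ coefficients≡
      c₂≡ = proj₂ coefficients≡
      comb′ : IsComb k (target b′ i′) (coefficient₁ b i) (p₁ , q₁) (coefficient₂ b i) (p₂ , q₂)
      comb′ = subst₂ (λ c₁ c₂ → IsComb k (target b′ i′) c₁ (p₁ , q₁) c₂ (p₂ , q₂))
          (sym c₁≡) (sym c₂≡) (coefficients-comb b′ i′)
      same-target : target b i ≡ target b′ i′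
      same-target = IsComb-unique k {target b i} {target b′ i′} {p₁ , q₁} {p₂ , q₂}
        (coefficient₁ b i) (coefficient₂ b i) (coefficients-comb b i) comb′

    2k≤s² : 2 ℕ.* k ≤ suc (2 ℕ.* m) ℕ.* suc (2 ℕ.* m)
    2k≤s² = ×-injective⇒≤ {2} {k} {suc (2 ℕ.* m)} {suc (2 ℕ.* m)} code (λ {x} {y} → code-injective {x} {y})

  ∣m⊖n∣≤o : ∀ m n {o} → m ≤ n ℕ.+ o → n ≤ m ℕ.+ o → ∣ m ⊖ n ∣ ≤ o
  ∣m⊖n∣≤o m n m≤n+o n≤m+o with ℕ.≤-total m n
  ... | inj₁ m≤n = subst (_≤ _) (sym (ℤ.∣⊖∣-≤ m≤n)) (ℕ.m≤n+o⇒m∸n≤o n m n≤m+o)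
  ... | inj₂ n≤m = subst (_≤ _) (trans (sym (ℤ.∣⊖∣-≤ n≤m)) (ℤ.∣m⊖n∣≡∣n⊖m∣ n m))
                     (ℕ.m≤n+o⇒m∸n≤o m n m≤n+o)

  balanced-digits : ∀ m N → N < suc m ℕ.* suc (2 ℕ.* m) →
    ∃₂ λ u v → ∣ u ∣ ≤ m × ∣ v ∣ ≤ m × (+ 1 + + 2 * + m) * u - v ≡ + N - + m
  balanced-digits m N N<[m+1]s = + q , + m - + r , q≤m , ∣m-r∣≤m , value
    where
    s = suc (2 ℕ.* m)
    q = N / s
    r = N % s
    q≤m : q ≤ m
    q≤m = ℕ.≤-pred (m<n*o⇒m/o<n N<[m+1]s)
    r≤m+m : r ≤ m ℕ.+ m
    r≤m+m = subst (r ≤_) (cong (m ℕ.+_) (ℕ.+-identityʳ m)) (ℕ.≤-pred (m%n<n N s))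
    ∣m-r∣≤m : ∣ + m - + r ∣ ≤ m
    ∣m-r∣≤m = subst (_≤ m) (cong ∣_∣ (sym (ℤ.[+m]-[+n]≡m⊖n m r))) (∣m⊖n∣≤o m r (ℕ.m≤n+m m r) r≤m+m)
    rearrange : ∀ s q m r → s * q - (m - r) ≡ (r + q * s) - m
    rearrange = solve-∀
    value : (+ 1 + + 2 * + m) * + q - (+ m - + r) ≡ + N - + m
    value = begin
      (+ 1 + + 2 * + m) * + q - (+ m - + r) ≡⟨ cong (λ t → (+ 1 + t) * + q - (+ m - + r)) (ℤ.pos-* 2 m) ⟨
      + s * + q - (+ m - + r)     ≡⟨ rearrange (+ s) (+ q) (+ m) (+ r) ⟩
      (+ r + + q * + s) - + m     ≡⟨ cong (λ t → (+ r + t) - + m) (ℤ.pos-* q s) ⟨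
      + (r ℕ.+ q ℕ.* s) - + m     ≡⟨ cong (λ t → + t - + m) (m≡m%n+[m/n]*n N s) ⟨
      + N - + m                   ∎
      where open ≡-Reasoning

  -- l₁ a₁ + l₂ a₂ = (x , n) for a₁ = (1 , m) and a₂ = (1 , m + 1), before reducing n mod 2k.
  Represents : ℕ → Fin 2 → ℤ → Set
  Represents m x n = ∃₂ λ l₁ l₂ → (∣ l₁ ∣ ℕ.+ ∣ l₂ ∣ ≤ suc (2 ℕ.* m)) ×
    (+ 2 ∣ (l₁ + l₂) - ⟦ x ⟧) × (+ m * l₁ + (+ 1 + + m) * l₂ ≡ n)

  represents-neg : ∀ {m x n} → Represents m x n → Represents m x (- n)
  represents-neg {m} {x} {n} (l₁ , l₂ , bounded , parity , value) =
    - l₁ , - l₂ ,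
    subst₂ (λ a b → a ℕ.+ b ≤ _) (sym (ℤ.∣-i∣≡∣i∣ l₁)) (sym (ℤ.∣-i∣≡∣i∣ l₂)) bounded ,
    subst (+ 2 ∣_) (negate-parity l₁ l₂ ⟦ x ⟧)
      (∣m∣n⇒∣m-n (∣m⇒∣-m parity) (∣n⇒∣m*n ⟦ x ⟧ ∣-refl)) ,
    trans (negate-value (+ m) l₁ l₂) (cong -_ value)
    where
    negate-parity : ∀ l₁ l₂ x → - ((l₁ + l₂) - x) - x * + 2 ≡ (- l₁ + - l₂) - x
    negate-parity = solve-∀
    negate-value : ∀ m l₁ l₂ → m * - l₁ + (+ 1 + m) * - l₂ ≡ - (m * l₁ + (+ 1 + m) * l₂)
    negate-value = solve-∀

  ∣2w+x∣≤2m+1 : ∀ {m} w (x : Fin 2) → ∣ w ∣ ≤ m → ∣ (w + w) + ⟦ x ⟧ ∣ ≤ suc (2 ℕ.* m)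
  ∣2w+x∣≤2m+1 {m} w x ∣w∣≤m = begin
    ∣ (w + w) + ⟦ x ⟧ ∣            ≤⟨ ℤ.∣i+j∣≤∣i∣+∣j∣ (w + w) ⟦ x ⟧ ⟩
    ∣ w + w ∣ ℕ.+ toℕ x            ≤⟨ ℕ.+-mono-≤ (ℤ.∣i+j∣≤∣i∣+∣j∣ w w) (ℕ.≤-pred (Fin.toℕ<n x)) ⟩
    (∣ w ∣ ℕ.+ ∣ w ∣) ℕ.+ 1        ≤⟨ ℕ.+-monoˡ-≤ 1 (ℕ.+-mono-≤ ∣w∣≤m ∣w∣≤m) ⟩
    (m ℕ.+ m) ℕ.+ 1                ≡⟨ ℕ.+-comm (m ℕ.+ m) 1 ⟩
    suc (m ℕ.+ m)                  ≡⟨ cong (λ t → suc (m ℕ.+ t)) (ℕ.+-identityʳ m) ⟨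
    suc (2 ℕ.* m)                  ∎
    where open ℕ.≤-Reasoning

  represents-balanced : ∀ m x u v → ∣ u ∣ ≤ m → ∣ v ∣ ≤ m →
    Represents m x (((+ 1 + + 2 * + m) * u - v) + + m * ⟦ x ⟧)
  represents-balanced m x u v ∣u∣≤m ∣v∣≤m =
    l₁ , l₂ ,
    ∣i±j∣≤n⇒∣i∣+∣j∣≤n l₁ l₂
      (subst (λ t → ∣ t ∣ ≤ _) (sym (sum u v ⟦ x ⟧)) (∣2w+x∣≤2m+1 u x ∣u∣≤m))
      (subst (λ t → ∣ t ∣ ≤ _) (sym (difference u v ⟦ x ⟧)) (∣2w+x∣≤2m+1 v x ∣v∣≤m)) ,
    divides u (parity u v ⟦ x ⟧) ,
    value (+ m) u v ⟦ x ⟧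
    where
    l₁ = (u + v) + ⟦ x ⟧
    l₂ = u - v
    sum : ∀ u v x → ((u + v) + x) + (u - v) ≡ (u + u) + x
    sum = solve-∀
    difference : ∀ u v x → ((u + v) + x) - (u - v) ≡ (v + v) + x
    difference = solve-∀
    parity : ∀ u v x → (((u + v) + x) + (u - v)) - x ≡ u * + 2
    parity = solve-∀
    value : ∀ m u v x → m * ((u + v) + x) + (+ 1 + m) * (u - v) ≡ ((+ 1 + + 2 * m) * u - v) + m * x
    value = solve-∀

  n+m<[m+1]s : ∀ m n → n ≤ m ℕ.* suc (2 ℕ.* m) ℕ.+ m → n ℕ.+ m < suc m ℕ.* suc (2 ℕ.* m)
  n+m<[m+1]s m n n≤ms+m = begin-strict
    n ℕ.+ m                                    ≤⟨ ℕ.+-monoˡ-≤ m n≤ms+m ⟩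
    m ℕ.* suc (2 ℕ.* m) ℕ.+ m ℕ.+ m            <⟨ ℕ.n<1+n _ ⟩
    suc (m ℕ.* suc (2 ℕ.* m) ℕ.+ m ℕ.+ m)      ≡⟨ expand m ⟩
    suc m ℕ.* suc (2 ℕ.* m)                    ∎
    where
    open ℕ.≤-Reasoning
    expand : ∀ m → suc (m ℕ.* suc (2 ℕ.* m) ℕ.+ m ℕ.+ m) ≡ suc m ℕ.* suc (2 ℕ.* m)
    expand = ℕ-Solver.solve-∀

  cover-ℕ : ∀ m x n → n ≤ m ℕ.* suc (2 ℕ.* m) ℕ.+ m → Represents m x (+ n)
  cover-ℕ m zero n n≤ms+m with balanced-digits m (n ℕ.+ m) (n+m<[m+1]s m n n≤ms+m)
  ... | u , v , ∣u∣≤m , ∣v∣≤m , digits = subst (Represents m zero)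
    (trans (cong (λ t → t + + m * + 0) digits) (cancel (+ n) (+ m)))
    (represents-balanced m zero u v ∣u∣≤m ∣v∣≤m)
    where
    cancel : ∀ n m → ((n + m) - m) + m * + 0 ≡ n
    cancel = solve-∀
  cover-ℕ m (suc zero) n n≤ms+m
    with balanced-digits m n (ℕ.≤-<-trans (ℕ.m≤m+n n m) (n+m<[m+1]s m n n≤ms+m))
  ... | u , v , ∣u∣≤m , ∣v∣≤m , digits = subst (Represents m (suc zero))
    (trans (cong (λ t → t + + m * + 1) digits) (cancel (+ n) (+ m)))
    (represents-balanced m (suc zero) u v ∣u∣≤m ∣v∣≤m)
    where
    cancel : ∀ n m → (n - m) + m * + 1 ≡ n
    cancel = solve-∀

  cover : ∀ m x n → ∣ n ∣ ≤ m ℕ.* suc (2 ℕ.* m) ℕ.+ m → Represents m x n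
  cover m x (+ n)      ∣n∣≤ = cover-ℕ m x n ∣n∣≤
  cover m x -[1+ n ]   ∣n∣≤ = represents-neg {m} {x} (cover-ℕ m x (suc n) ∣n∣≤)

  small-representative : ∀ k (y : Fin (2 ℕ.* k)) → ∃ λ n → ∣ n ∣ ≤ k × + (2 ℕ.* k) ∣ n - ⟦ y ⟧
  small-representative k y with toℕ y ℕ.≤? k
  ... | yes y≤k = ⟦ y ⟧ , y≤k , divides (+ 0) (ℤ.+-inverseʳ ⟦ y ⟧)
  ... | no  y≰k = ⟦ y ⟧ - + (2 ℕ.* k) , ∣y-2k∣≤k , divides (- + 1) (shift ⟦ y ⟧ (+ (2 ℕ.* k)))
    where
    shift : ∀ y d → (y - d) - y ≡ - + 1 * d
    shift = solve-∀
    2k≤y+k : 2 ℕ.* k ≤ toℕ y ℕ.+ k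
    2k≤y+k = begin
      2 ℕ.* k            ≡⟨ cong (k ℕ.+_) (ℕ.+-identityʳ k) ⟩
      k ℕ.+ k            ≤⟨ ℕ.+-monoˡ-≤ k (ℕ.<⇒≤ (ℕ.≰⇒> y≰k)) ⟩
      toℕ y ℕ.+ k        ∎
      where open ℕ.≤-Reasoning
    ∣y-2k∣≤k : ∣ ⟦ y ⟧ - + (2 ℕ.* k) ∣ ≤ k
    ∣y-2k∣≤k = subst (_≤ k)
      (trans (sym (ℤ.∣⊖∣-≤ (ℕ.<⇒≤ (Fin.toℕ<n y)))) (cong ∣_∣ (sym (ℤ.[+m]-[+n]≡m⊖n (toℕ y) (2 ℕ.* k)))))
      (ℕ.m≤n+o⇒m∸n≤o (2 ℕ.* k) (toℕ y) 2k≤y+k)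

  combination-congruent : ∀ {d} l₁ l₂ r₁ r₂ c₁ c₂ y → d ∣ r₁ - c₁ → d ∣ r₂ - c₂ →
    d ∣ (c₁ * l₁ + c₂ * l₂) - y → d ∣ (l₁ * r₁ + l₂ * r₂) - y
  combination-congruent l₁ l₂ r₁ r₂ c₁ c₂ y d∣r₁-c₁ d∣r₂-c₂ d∣c-y =
    subst (_ ∣_) (regroup l₁ l₂ r₁ r₂ c₁ c₂ y)
      (∣m∣n⇒∣m+n (∣m∣n⇒∣m+n (∣n⇒∣m*n l₁ d∣r₁-c₁) (∣n⇒∣m*n l₂ d∣r₂-c₂)) d∣c-y)
    where
    regroup : ∀ l₁ l₂ r₁ r₂ c₁ c₂ y →
      (l₁ * (r₁ - c₁) + l₂ * (r₂ - c₂)) + ((c₁ * l₁ + c₂ * l₂) - y) ≡ (l₁ * r₁ + l₂ * r₂) - y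
    regroup = solve-∀

  module Sufficiency {k m : ℕ} .{{_ : NonZero k}} (k≤ms+m : k ≤ m ℕ.* suc (2 ℕ.* m) ℕ.+ m) where

    instance
      2k≢0 : NonZero (2 ℕ.* k)
      2k≢0 = ℕ.m*n≢0 2 k

    a₁ a₂ : G k
    a₁ = suc zero , residue (2 ℕ.* k) (+ m)
    a₂ = suc zero , residue (2 ℕ.* k) (+ 1 + + m)

    a₁≢a₂ : ¬ a₁ ≡ a₂
    a₁≢a₂ eq = 2∤1 (subst (+ 2 ∣_) (minus-one (+ m)) (∣m⇒∣-m (∣-trans (2∣2k k)
      (residue≡⇒∣ (2 ℕ.* k) (+ m) (+ 1 + + m) (cong proj₂ eq)))))
      where
      minus-one : ∀ m → - (m - (+ 1 + m)) ≡ + 1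
      minus-one = solve-∀

    spanning : IsSpanning k (suc (2 ℕ.* m)) a₁ a₂
    spanning (x , y) with small-representative k y
    ... | n , ∣n∣≤k , 2k∣n-y with cover m x n (ℕ.≤-trans ∣n∣≤k k≤ms+m)
    ... | l₁ , l₂ , bounded , parity , value =
      l₁ , l₂ , bounded ,
      ∣⇒∣ᵤ (subst (λ t → + 2 ∣ t - ⟦ x ⟧) (sym (cong₂ _+_ (ℤ.*-identityʳ l₁) (ℤ.*-identityʳ l₂))) parity) ,
      ∣⇒∣ᵤ (combination-congruent l₁ l₂ _ _ (+ m) (+ 1 + + m) ⟦ y ⟧
        (residue-congruent (2 ℕ.* k) (+ m)) (residue-congruent (2 ℕ.* k) (+ 1 + + m))
        (subst (λ t → + (2 ℕ.* k) ∣ t - ⟦ y ⟧) (sym value) 2k∣n-y))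

    hasSpanningSet : HasSpanningSetOfSize2 k (suc (2 ℕ.* m))
    hasSpanningSet = a₁ , a₂ , a₁≢a₂ , spanning

  odd-square : ∀ m → suc (2 ℕ.* m) ℕ.* suc (2 ℕ.* m) ≡ suc (2 ℕ.* (m ℕ.* suc (2 ℕ.* m) ℕ.+ m))
  odd-square = ℕ-Solver.solve-∀

  [s²-1]/2≡ms+m : ∀ m → (suc (2 ℕ.* m) ℕ.* suc (2 ℕ.* m) ℕ.∸ 1) / 2 ≡ m ℕ.* suc (2 ℕ.* m) ℕ.+ m
  [s²-1]/2≡ms+m m = begin
    (suc (2 ℕ.* m) ℕ.* suc (2 ℕ.* m) ℕ.∸ 1) / 2    ≡⟨ cong (λ t → (t ℕ.∸ 1) / 2) (odd-square m) ⟩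
    (2 ℕ.* (m ℕ.* suc (2 ℕ.* m) ℕ.+ m)) / 2         ≡⟨ cong (_/ 2) (ℕ.*-comm 2 (m ℕ.* suc (2 ℕ.* m) ℕ.+ m)) ⟩
    ((m ℕ.* suc (2 ℕ.* m) ℕ.+ m) ℕ.* 2) / 2         ≡⟨ m*n/n≡m (m ℕ.* suc (2 ℕ.* m) ℕ.+ m) 2 ⟩
    m ℕ.* suc (2 ℕ.* m) ℕ.+ m                       ∎
    where open ≡-Reasoning

  2k≤s²⇒k≤ms+m : ∀ k m → 2 ℕ.* k ≤ suc (2 ℕ.* m) ℕ.* suc (2 ℕ.* m) → k ≤ m ℕ.* suc (2 ℕ.* m) ℕ.+ m
  2k≤s²⇒k≤ms+m k m 2k≤s² = ℕ.≤-pred (ℕ.*-cancelˡ-< 2 k (suc (m ℕ.* suc (2 ℕ.* m) ℕ.+ m)) (begin-strict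
    2 ℕ.* k                                      ≤⟨ 2k≤s² ⟩
    suc (2 ℕ.* m) ℕ.* suc (2 ℕ.* m)              ≡⟨ odd-square m ⟩
    suc (2 ℕ.* (m ℕ.* suc (2 ℕ.* m) ℕ.+ m))      <⟨ ℕ.n<1+n _ ⟩
    2 ℕ.+ 2 ℕ.* (m ℕ.* suc (2 ℕ.* m) ℕ.+ m)      ≡⟨ ℕ.*-suc 2 (m ℕ.* suc (2 ℕ.* m) ℕ.+ m) ⟨
    2 ℕ.* suc (m ℕ.* suc (2 ℕ.* m) ℕ.+ m)        ∎))
    where open ℕ.≤-Reasoning

  theorem-for-odd : ∀ k m → 1 ≤ k →
    HasSpanningSetOfSize2 k (suc (2 ℕ.* m)) ⇔ k ≤ (suc (2 ℕ.* m) ℕ.* suc (2 ℕ.* m) ℕ.∸ 1) / 2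
  theorem-for-odd k m 1≤k = mk⇔
    (λ { ((p₁ , q₁) , (p₂ , q₂) , _ , spanning) → subst (k ≤_) (sym ([s²-1]/2≡ms+m m))
           (2k≤s²⇒k≤ms+m k m (Necessity.2k≤s² {k} {m} spanning)) })
    (λ k≤[s²-1]/2 → Sufficiency.hasSpanningSet {k} {m} (subst (k ≤_) ([s²-1]/2≡ms+m m) k≤[s²-1]/2))
    where instance _ = ℕ.>-nonZero 1≤k

  odd⇒≡1+2[n/2] : ∀ n → n % 2 ≡ 1 → n ≡ suc (2 ℕ.* (n / 2))
  odd⇒≡1+2[n/2] n n-odd = trans (m≡m%n+[m/n]*n n 2) (cong₂ ℕ._+_ n-odd (ℕ.*-comm (n / 2) 2))

open import Data.Nat using (ℕ; _≤_; _*_; _∸_; _/_; _%_)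
open import Relation.Binary.PropositionalEquality using (_≡_)
open import Function.Bundles using (_⇔_)
open import Relation.Binary.PropositionalEquality using (subst; sym)

mainTheorem12 : (k s : ℕ) → 1 ≤ k → 1 ≤ s → s % 2 ≡ 1 →
    (HasSpanningSetOfSize2 k s ⇔ k ≤ (s * s ∸ 1) / 2)
mainTheorem12 k s 1≤k _ s-odd =
  subst (λ s → HasSpanningSetOfSize2 k s ⇔ k ≤ (s * s ∸ 1) / 2)
    (sym (odd⇒≡1+2[n/2] s s-odd)) (theorem-for-odd k (s / 2) 1≤k)
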